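{- Let $T:\mathbb{Z}_{>0}\to\mathbb{Z}_{>0}$ be defined by $T(n)=(3n+1)/2$ if $n$ is odd and $T(n)=n/2$ if $n$ is even. For $j\ge 1$ let $I_0(j,j-1)$ be the set of integers $n$ with $1\le n\le 2^j$ such that exactly $j-1$ of the integers $n,T(n),\ldots,T^{(j-1)}(n)$ are odd. For positive integers $k,l$ let $b_k(l)$ denote the unique integer in $\{1,\ldots,3^k-1\}$ congruent to $2^{ -l}$ modulo $3^k$ (i.e. the least positive residue of the inverse of $2^l$ modulo $3^k$). Let $j\ge 2$, and set $n_{j,0}=2^j-2$ and $$n_{j,k}=\left(\tfrac23\right)^k\left(b_k(j-k)\cdot 2^{j-k}-1\right)-1\quad (1\le k\le j-1).$$ Then $I_0(j,j-1)=\{n_{j,k}:0\le k\le j-1\}$, and every element of $I_0(j,j-1)$ is at least $2^{j/(1+\rho)}-2$, where $\rho=\log_2 3$.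
   Context: $T^{(k)}$ denotes the $k$-th iterate of $T$ (with $T^{(0)}$ the identity). -}

module Defs where

open import Data.Nat using (ℕ; zero; suc; _+_; _*_; _∸_; _^_; _≤_; _<_; _≡ᵇ_)
open import Data.Nat.DivMod using (_/_; _%_)
open import Data.Nat.Properties using (m^n≢0)
open import Data.Bool using (Bool; true; false; if_then_else_)
open import Data.Product using (_×_)
open import Relation.Binary.PropositionalEquality using (_≡_)

-- The map T (defined on all of ℕ; only its values on positive integers matter).
T : ℕ → ℕ
T n with n % 2
... | zero  = n / 2
... | suc _ = (3 * n + 1) / 2

iter : ℕ → ℕ → ℕ
iter zero    n = n
iter (suc k) n = T (iter k n)

isOdd : ℕ → Bool
isOdd n = (n % 2) ≡ᵇ 1

oddCount : ℕ → ℕ → ℕ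
oddCount zero    n = 0
oddCount (suc j) n = oddCount j n + (if isOdd (iter j n) then 1 else 0)

InI0 : ℕ → ℕ → Set
InI0 j n = (1 ≤ n) × (n ≤ 2 ^ j) × (oddCount j n ≡ j ∸ 1)

-- first m in {s, s+1, ..., s+fuel-1} with p m = true (0 if none)
findFrom : (ℕ → Bool) → ℕ → ℕ → ℕ
findFrom p s zero = 0
findFrom p s (suc fuel) = if p s then s else findFrom p (suc s) fuel

b : ℕ → ℕ → ℕ
b k l = findFrom (λ m → ((m * 2 ^ l) % (3 ^ k)) {{m^n≢0 3 k}} ≡ᵇ 1) 1 (3 ^ k ∸ 1)

-- n_{j,0} = 2^j - 2,
-- n_{j,k} = (2/3)^k (b_k(j-k) 2^(j-k) - 1) - 1   (k ≥ 1);
-- the division by 3^k is exact since b_k(j-k) 2^(j-k) ≡ 1 (mod 3^k).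
nj : ℕ → ℕ → ℕ
nj j zero = 2 ^ j ∸ 2
nj j (suc k') = ((2 ^ k * (b k (j ∸ k) * 2 ^ (j ∸ k) ∸ 1)) / (3 ^ k)) {{m^n≢0 3 k}} ∸ 1
  where k = suc k'

-- LowerBound j x  expresses the real inequality  2^{j/(1+ρ)} ≤ x  (ρ = log₂ 3, x ≥ 1),
-- i.e.  j ≤ (1 + ρ) · log₂ x, via rational upper approximations:
-- for all rationals r/s > log₂ x  (x^s < 2^r)  and  p/q > ρ  (3^q < 2^p)
-- we have  j < (r/s)(1 + p/q),  i.e.  j·s·q < r·(q + p).
LowerBound : ℕ → ℕ → Set
LowerBound j x = ∀ p q r s → 1 ≤ q → 1 ≤ s → 3 ^ q < 2 ^ p → x ^ s < 2 ^ r
                 → j * s * q < r * (q + p)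

-- Odd-run lemma: n, T n, …, T^(p−1) n are all odd iff n + 1 = 2^p y, and then
-- T^(p) n + 1 = 3^p y.  Hence, writing j = p + q + 1 with T^(p) n the unique even
-- value of the orbit, n ∈ I₀(j, j−1) iff n has the Shape
--     n + 1 = 2^p y,   3^p y + 1 = 2^(q+1) z,
-- plus 1 ≤ n ≤ 2^j.  Under n ≤ 2^j the shape is rigid: for p = 0 it forces z = 1,
-- i.e. n = 2^j − 2 = n_{j,0}; for p = k ≥ 1 it forces 1 ≤ z < 3^k, so z is the
-- inverse b_k(q+1) of 2^(q+1) modulo 3^k (inverses modulo odd numbers are unique)
-- and n = 2^k y − 1 = n_{j,k}.  Conversely the inverse exists and produces an
-- element of this shape.  Finally a shape gives 2^j ≤ 3^p (n + 2) and 2^p ≤ n + 2,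
-- which yield j ≤ (1 + ρ) log₂ (n + 2), expressed by rational approximations.
module Submission where

open import Defs
open import Data.Nat using (ℕ; zero; suc; _+_; _*_; _∸_; _^_; _≤_; _<_; z≤n; s≤s; s≤s⁻¹; s<s⁻¹; NonZero; >-nonZero; ≢-nonZero; _≡ᵇ_; _≤?_)
open import Data.Nat.Properties
open import Data.Nat.DivMod using (_/_; _%_; m*n%n≡0; m*n/n≡m; [m+kn]%n≡m%n; m≡m%n+[m/n]*n; m<n⇒m%n≡m)
open import Algebra.Properties.CommutativeSemigroup *-commutativeSemigroup using (x∙yz≈y∙xz; xy∙z≈y∙xz; x∙yz≈yx∙z)
open import Data.Nat.Divisibility using (_∣_; divides; >⇒∤)
open import Data.Nat.Tactic.RingSolver using (solve-∀)
open import Data.Bool using (Bool; true; false; if_then_else_) renaming (T to True)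
open import Data.Product using (_×_; _,_; ∃-syntax; proj₁; proj₂)
open import Data.Sum using (_⊎_; inj₁; inj₂)
open import Data.Empty using (⊥-elim)
open import Data.Unit using (tt)
open import Relation.Nullary using (yes; no)
open import Relation.Binary.PropositionalEquality
open import Function.Bundles using (_⇔_; mk⇔)

Even Odd : ℕ → Set
Even n = ∃[ h ] n ≡ 2 * h
Odd  n = ∃[ h ] n ≡ suc (2 * h)

parity : ∀ n → Even n ⊎ Odd n
parity zero = inj₁ (0 , refl)
parity (suc n) with parity n
... | inj₁ (h , refl) = inj₂ (h , refl)
... | inj₂ (h , refl) = inj₁ (suc h , sym (*-suc 2 h))

odd-* : ∀ {a c} → Odd a → Odd c → Odd (a * c)
odd-* (x , refl) (y , refl) = x + y + 2 * x * y , expand x y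
  where
  expand : ∀ x y → suc (2 * x) * suc (2 * y) ≡ suc (2 * (x + y + 2 * x * y))
  expand = solve-∀

odd-3^ : ∀ p → Odd (3 ^ p)
odd-3^ zero = 0 , refl
odd-3^ (suc p) = odd-* (1 , refl) (odd-3^ p)

even%2 : ∀ h → 2 * h % 2 ≡ 0
even%2 h = trans (cong (_% 2) (*-comm 2 h)) (m*n%n≡0 h 2)

odd%2 : ∀ h → suc (2 * h) % 2 ≡ 1
odd%2 h = trans (cong (λ x → suc x % 2) (*-comm 2 h)) ([m+kn]%n≡m%n 1 h 2)

T-by-residue : ∀ n → (n % 2 ≡ 0 → T n ≡ n / 2) × (n % 2 ≡ 1 → T n ≡ (3 * n + 1) / 2)
T-by-residue n with n % 2
... | zero  = (λ _ → refl) , λ ()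
... | suc r = (λ ()) , λ _ → refl

T-even : ∀ h → T (2 * h) ≡ h
T-even h = begin
  T (2 * h)   ≡⟨ proj₁ (T-by-residue (2 * h)) (even%2 h) ⟩
  2 * h / 2   ≡⟨ cong (_/ 2) (*-comm 2 h) ⟩
  h * 2 / 2   ≡⟨ m*n/n≡m h 2 ⟩
  h           ∎
  where open ≡-Reasoning

T-odd : ∀ h → T (suc (2 * h)) ≡ suc (suc (3 * h))
T-odd h = begin
  T (suc (2 * h))                 ≡⟨ proj₂ (T-by-residue (suc (2 * h))) (odd%2 h) ⟩
  (3 * suc (2 * h) + 1) / 2       ≡⟨ cong (_/ 2) (regroup h) ⟩
  suc (suc (3 * h)) * 2 / 2       ≡⟨ m*n/n≡m _ 2 ⟩
  suc (suc (3 * h))               ∎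
  where
  open ≡-Reasoning
  regroup : ∀ h → 3 * suc (2 * h) + 1 ≡ suc (suc (3 * h)) * 2
  regroup = solve-∀

isOdd-even : ∀ h → isOdd (2 * h) ≡ false
isOdd-even h = cong (_≡ᵇ 1) (even%2 h)

isOdd-odd : ∀ h → isOdd (suc (2 * h)) ≡ true
isOdd-odd h = cong (_≡ᵇ 1) (odd%2 h)

isOdd-false⇒even : ∀ x → isOdd x ≡ false → Even x
isOdd-false⇒even x e with parity x
... | inj₁ ev = ev
... | inj₂ (h , refl) with () ← trans (sym (isOdd-odd h)) e

isOdd-true⇒odd : ∀ x → isOdd x ≡ true → Odd x
isOdd-true⇒odd x e with parity x
... | inj₂ od = od
... | inj₁ (h , refl) with () ← trans (sym (isOdd-even h)) e

oddBit : ℕ → ℕ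
oddBit x = if isOdd x then 1 else 0

oddBit≤1 : ∀ x → oddBit x ≤ 1
oddBit≤1 x with isOdd x
... | true  = ≤-refl
... | false = z≤n

iter-+ : ∀ c a n → iter (c + a) n ≡ iter c (iter a n)
iter-+ zero    a n = refl
iter-+ (suc c) a n = cong T (iter-+ c a n)

oddCount-+ : ∀ c a n → oddCount (c + a) n ≡ oddCount a n + oddCount c (iter a n)
oddCount-+ zero    a n = sym (+-identityʳ _)
oddCount-+ (suc c) a n = begin
  oddCount (c + a) n + oddBit (iter (c + a) n)
    ≡⟨ cong₂ _+_ (oddCount-+ c a n) (cong oddBit (iter-+ c a n)) ⟩
  oddCount a n + oddCount c (iter a n) + oddBit (iter c (iter a n))
    ≡⟨ +-assoc (oddCount a n) _ _ ⟩
  oddCount a n + (oddCount c (iter a n) + oddBit (iter c (iter a n))) ∎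
  where open ≡-Reasoning

oddCount≤ : ∀ j n → oddCount j n ≤ j
oddCount≤ zero    n = z≤n
oddCount≤ (suc j) n = ≤-trans (+-mono-≤ (oddCount≤ j n) (oddBit≤1 (iter j n))) (≤-reflexive (+-comm j 1))

-- Odd runs.  If n + 1 = 2^p y, the first p values are odd: each odd step
-- m ↦ (3m + 1)/2 multiplies m + 1 by 3/2, so T^(p) n + 1 = 3^p y.
-- Conversely p odd values at the start force 2^p ∣ n + 1.

odd-below-even : ∀ m c → m + 1 ≡ 2 * c → ∃[ w ] (c ≡ suc w × m ≡ suc (2 * w))
odd-below-even m zero    e = ⊥-elim (m+1+n≢0 m e)
odd-below-even m (suc w) e = w , refl , suc-injective (begin
  suc m              ≡⟨ +-comm 1 m ⟩
  m + 1              ≡⟨ e ⟩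
  2 * suc w          ≡⟨ *-suc 2 w ⟩
  suc (suc (2 * w))  ∎)
  where open ≡-Reasoning

even-below-even : ∀ m c → m + 1 + 1 ≡ 2 * c → ∃[ u ] (c ≡ suc u × m ≡ 2 * u)
even-below-even m c e with odd-below-even (m + 1) c e
... | u , c≡ , m+1≡ = u , c≡ , suc-injective (trans (+-comm 1 m) m+1≡)

oddRun : ∀ p n y → n + 1 ≡ 2 ^ p * y → oddCount p n ≡ p × iter p n + 1 ≡ 3 ^ p * y
oddRun zero    n y e = refl , e
oddRun (suc p) n y e with oddRun p n (2 * y) (trans e (xy∙z≈y∙xz 2 (2 ^ p) y))
... | count , last with odd-below-even (iter p n) (3 ^ p * y) (trans last (x∙yz≈y∙xz (3 ^ p) 2 y))
... | w , 3^py≡ , odd-last = count′ , last′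
  where
  open ≡-Reasoning
  count′ : oddCount p n + oddBit (iter p n) ≡ suc p
  count′ = begin
    oddCount p n + oddBit (iter p n)  ≡⟨ cong₂ _+_ count (cong oddBit odd-last) ⟩
    p + oddBit (suc (2 * w))          ≡⟨ cong (λ b → p + (if b then 1 else 0)) (isOdd-odd w) ⟩
    p + 1                             ≡⟨ +-comm p 1 ⟩
    suc p                             ∎
  last′ : T (iter p n) + 1 ≡ 3 * 3 ^ p * y
  last′ = begin
    T (iter p n) + 1        ≡⟨ cong (λ x → T x + 1) odd-last ⟩
    T (suc (2 * w)) + 1     ≡⟨ cong (_+ 1) (T-odd w) ⟩
    suc (suc (3 * w)) + 1   ≡⟨ trans (+-comm _ 1) (sym (*-suc 3 w)) ⟩
    3 * suc w               ≡⟨ cong (3 *_) (sym 3^py≡) ⟩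
    3 * (3 ^ p * y)         ≡⟨ sym (*-assoc 3 (3 ^ p) y) ⟩
    3 * 3 ^ p * y           ∎

-- Its converse, by induction: if the first p + 1 values are odd then n + 1 = 2^p y,
-- and T^(p) n = 3^p y − 1 being odd forces y to be even.
oddRun⁻¹ : ∀ p n → oddCount p n ≡ p → ∃[ y ] n + 1 ≡ 2 ^ p * y
oddRun⁻¹ zero    n _ = n + 1 , sym (*-identityˡ (n + 1))
oddRun⁻¹ (suc p) n e with isOdd (iter p n) in eo
... | false = ⊥-elim (1+n≰n (≤-trans (≤-reflexive (trans (sym e) (+-identityʳ _))) (oddCount≤ p n)))
... | true with oddRun⁻¹ p n (suc-injective (trans (+-comm 1 _) e))
... | y , head with parity y
...   | inj₁ (g , refl) = g , trans head (sym (xy∙z≈y∙xz 2 (2 ^ p) g))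
...   | inj₂ odd-y with isOdd-true⇒odd (iter p n) eo | odd-* (odd-3^ p) odd-y
...     | h , eh | k , ek = ⊥-elim (even≢odd (suc h) k (begin
          2 * suc h        ≡⟨ trans (*-suc 2 h) (+-comm 1 (suc (2 * h))) ⟩
          suc (2 * h) + 1  ≡⟨ cong (_+ 1) (sym eh) ⟩
          iter p n + 1     ≡⟨ proj₂ (oddRun p n y head) ⟩
          3 ^ p * y        ≡⟨ ek ⟩
          suc (2 * k)      ∎))
  where open ≡-Reasoning

-- With j = p + q + 1 and T^(p) n the unique even value
-- among n, …, T^(j−1) n, the orbit consists of p odd values, one even value and
-- q odd values; by the odd-run lemma this is exactly the following arithmetic shape.
record Shape (p q n : ℕ) : Set where
  constructor shape
  field
    y z    : ℕ
    before : n + 1 ≡ 2 ^ p * y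
    after  : 3 ^ p * y + 1 ≡ 2 ^ suc q * z

HasShape : ℕ → ℕ → Set
HasShape j n = ∃[ p ] ∃[ q ] (j ≡ suc (p + q) × Shape p q n)

evenStep : ∀ j n → oddCount j n + 1 ≡ j
         → ∃[ p ] ∃[ q ] (j ≡ suc (p + q) × oddCount p n ≡ p × Even (iter p n)
                          × oddCount q (iter (suc p) n) ≡ q)
evenStep zero    n ()
evenStep (suc J) n e with isOdd (iter J n) in eo
... | false = J , 0 , cong suc (sym (+-identityʳ J))
            , suc-injective (trans (+-comm 1 _) (trans (cong (_+ 1) (sym (+-identityʳ _))) e))
            , isOdd-false⇒even _ eo , refl
... | true with evenStep J n (suc-injective (trans (+-comm 1 _) e))
... | p , q , refl , run , even , rest = p , suc q , cong suc (sym (+-suc p q)) , run , even , rest′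
  where
  last-is-odd : oddBit (iter q (iter (suc p) n)) ≡ 1
  last-is-odd = begin
    oddBit (iter q (iter (suc p) n))  ≡⟨ cong oddBit (sym (iter-+ q (suc p) n)) ⟩
    oddBit (iter (q + suc p) n)       ≡⟨ cong (λ v → oddBit (iter v n)) (trans (+-suc q p) (cong suc (+-comm q p))) ⟩
    oddBit (iter (suc (p + q)) n)     ≡⟨ cong (λ b → if b then 1 else 0) eo ⟩
    1                                 ∎
    where open ≡-Reasoning
  rest′ : oddCount q (iter (suc p) n) + oddBit (iter q (iter (suc p) n)) ≡ suc q
  rest′ = trans (cong₂ _+_ rest last-is-odd) (+-comm q 1)

-- The odd runs before and after the even value give the two equations of the shape.
count⇒shape : ∀ j n → oddCount j n + 1 ≡ j → HasShape j n
count⇒shape j n e with evenStep j n e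
... | p , q , j≡ , run , (h , even) , rest with oddRun⁻¹ p n run
... | y , before with oddRun⁻¹ q h (subst (λ m → oddCount q m ≡ q) (trans (cong T even) (T-even h)) rest)
... | z , ez = p , q , j≡ , shape y z before after
  where
  open ≡-Reasoning
  double-succ : ∀ h → 2 * h + 1 + 1 ≡ 2 * (h + 1)
  double-succ = solve-∀
  after : 3 ^ p * y + 1 ≡ 2 ^ suc q * z
  after = begin
    3 ^ p * y + 1     ≡⟨ cong (_+ 1) (sym (proj₂ (oddRun p n y before))) ⟩
    iter p n + 1 + 1  ≡⟨ cong (λ m → m + 1 + 1) even ⟩
    2 * h + 1 + 1     ≡⟨ double-succ h ⟩
    2 * (h + 1)       ≡⟨ cong (2 *_) ez ⟩
    2 * (2 ^ q * z)   ≡⟨ sym (*-assoc 2 (2 ^ q) z) ⟩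
    2 ^ suc q * z     ∎

-- Conversely a shape produces exactly j − 1 odd values: p odd steps reach
-- T^(p) n = 3^p y − 1, which is even, and its half starts a run of q odd steps.
shape⇒count : ∀ p q n → Shape p q n → oddCount (suc (p + q)) n ≡ p + q
shape⇒count p q n (shape y z before after) with oddRun p n y before
... | run , last with even-below-even (iter p n) (2 ^ q * z) (trans (cong (_+ 1) last) (trans after (*-assoc 2 (2 ^ q) z)))
... | u , 2^qz≡ , even-mid = begin
  oddCount (suc (p + q)) n
    ≡⟨ cong (λ v → oddCount v n) (trans (cong suc (+-comm p q)) (sym (+-suc q p))) ⟩
  oddCount (q + suc p) n
    ≡⟨ oddCount-+ q (suc p) n ⟩
  oddCount p n + oddBit (iter p n) + oddCount q (iter (suc p) n)
    ≡⟨ cong₂ (λ a b → a + b + oddCount q (iter (suc p) n)) run mid-is-even ⟩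
  p + 0 + oddCount q (iter (suc p) n)
    ≡⟨ cong₂ _+_ (+-identityʳ p) rest ⟩
  p + q ∎
  where
  open ≡-Reasoning
  mid-is-even : oddBit (iter p n) ≡ 0
  mid-is-even = trans (cong oddBit even-mid) (cong (λ b → if b then 1 else 0) (isOdd-even u))
  rest : oddCount q (iter (suc p) n) ≡ q
  rest = begin
    oddCount q (T (iter p n))  ≡⟨ cong (λ m → oddCount q (T m)) even-mid ⟩
    oddCount q (T (2 * u))     ≡⟨ cong (oddCount q) (T-even u) ⟩
    oddCount q u               ≡⟨ proj₁ (oddRun q u z (trans (+-comm u 1) (sym 2^qz≡))) ⟩
    q                          ∎

InI0⇒shape : ∀ j n → 1 ≤ j → InI0 j n → HasShape j n
InI0⇒shape j n 1≤j (_ , _ , count) = count⇒shape j n (trans (cong (_+ 1) count) (m∸n+n≡m 1≤j))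

-- Inverses of powers of 2 modulo an odd number a.

odd∣2*⇒∣ : ∀ {a d} → Odd a → a ∣ 2 * d → a ∣ d
odd∣2*⇒∣ {a} {d} odd-a (divides e 2d≡ea) with parity e
... | inj₁ (e′ , refl) = divides e′ (*-cancelˡ-≡ d (e′ * a) 2 (trans 2d≡ea (*-assoc 2 e′ a)))
... | inj₂ odd-e with odd-* odd-e odd-a
... | k , ek = ⊥-elim (even≢odd d k (trans 2d≡ea ek))

odd∣*2^⇒∣ : ∀ {a} → Odd a → ∀ L {d} → a ∣ d * 2 ^ L → a ∣ d
odd∣*2^⇒∣ {a} odd-a zero    {d} a∣ = subst (a ∣_) (*-identityʳ d) a∣
odd∣*2^⇒∣ {a} odd-a (suc L) {d} a∣ =
  odd∣2*⇒∣ odd-a (odd∣*2^⇒∣ odd-a L (subst (a ∣_) (x∙yz≈yx∙z d 2 (2 ^ L)) a∣))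

divisor-of-smaller : ∀ {a x} → a ∣ x → x < a → x ≡ 0
divisor-of-smaller {x = zero}  _   _   = refl
divisor-of-smaller {x = suc _} a∣x x<a = ⊥-elim (>⇒∤ x<a a∣x)

-- Two inverses m ≤ z < a of 2^L modulo odd a coincide: a divides (z − m) 2^L,
-- hence z − m, which is smaller than a.
inverse-unique-≤ : ∀ {a} → Odd a → ∀ L {m z s t} → m ≤ z → z < a
                 → m * 2 ^ L ≡ 1 + s * a → z * 2 ^ L ≡ 1 + t * a → m ≡ z
inverse-unique-≤ {a} odd-a L {m} {z} {s} {t} m≤z z<a em ez =
  ≤-antisym m≤z (m∸n≡0⇒m≤n (divisor-of-smaller a∣z∸m (≤-<-trans (m∸n≤m z m) z<a)))
  where
  open ≡-Reasoning
  a∣z∸m : a ∣ z ∸ m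
  a∣z∸m = odd∣*2^⇒∣ odd-a L (divides (t ∸ s) (begin
    (z ∸ m) * 2 ^ L                   ≡⟨ *-distribʳ-∸ (2 ^ L) z m ⟩
    z * 2 ^ L ∸ m * 2 ^ L             ≡⟨ cong₂ _∸_ ez em ⟩
    (1 + t * a) ∸ (1 + s * a)         ≡⟨ sym (*-distribʳ-∸ a t s) ⟩
    (t ∸ s) * a                       ∎))

inverse-unique : ∀ {a} → Odd a → ∀ L {m z s t} → m < a → z < a
               → m * 2 ^ L ≡ 1 + s * a → z * 2 ^ L ≡ 1 + t * a → m ≡ z
inverse-unique odd-a L {m} {z} {s} {t} m<a z<a em ez with ≤-total m z
... | inj₁ m≤z = inverse-unique-≤ odd-a L {s = s} {t} m≤z z<a em ez
... | inj₂ z≤m = sym (inverse-unique-≤ odd-a L {s = t} {s} z≤m m<a ez em)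

-- For odd a > 1 the inverse of 2^L modulo a exists in {1, …, a − 1}: from an
-- inverse z of 2^L, z/2 (z even) or (z + a)/2 (z odd) is an inverse of 2^(L+1).
inverse-exists : ∀ {a} → Odd a → 1 < a → ∀ L → ∃[ z ] ∃[ y ] (1 ≤ z × z < a × z * 2 ^ L ≡ 1 + y * a)
inverse-exists _ 1<a zero = 1 , 0 , ≤-refl , 1<a , refl
inverse-exists {a} (h , refl) 1<a (suc L) with inverse-exists (h , refl) 1<a L
... | z , y , 1≤z , z<a , ez with parity z | 1≤z
... | inj₁ (zero , refl)  | ()
... | inj₁ (suc z′ , refl) | _ =
  suc z′ , y , s≤s z≤n , ≤-<-trans (m≤m+n (suc z′) _) z<a , trans (x∙yz≈yx∙z (suc z′) 2 (2 ^ L)) ez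
... | inj₂ (z′ , refl) | _ = suc (z′ + h) , y + 2 ^ L , s≤s z≤n , s≤s z′+h<2h , (begin
  suc (z′ + h) * (2 * 2 ^ L)                  ≡⟨ halve-sum z′ h (2 ^ L) ⟩
  suc (2 * z′) * 2 ^ L + suc (2 * h) * 2 ^ L  ≡⟨ cong (_+ suc (2 * h) * 2 ^ L) ez ⟩
  1 + y * suc (2 * h) + suc (2 * h) * 2 ^ L   ≡⟨ collect y (2 ^ L) (suc (2 * h)) ⟩
  1 + (y + 2 ^ L) * suc (2 * h)               ∎)
  where
  open ≡-Reasoning
  halve-sum : ∀ z′ h X → suc (z′ + h) * (2 * X) ≡ suc (2 * z′) * X + suc (2 * h) * X
  halve-sum = solve-∀
  collect : ∀ y X a → 1 + y * a + a * X ≡ 1 + (y + X) * a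
  collect = solve-∀
  z′+h<2h : z′ + h < 2 * h
  z′+h<2h = ≤-trans (+-monoˡ-< h (*-cancelˡ-< 2 z′ h (s<s⁻¹ z<a))) (≤-reflexive (cong (h +_) (sym (+-identityʳ h))))

findFrom-correct : ∀ P s fuel z → s ≤ z → z < s + fuel → P z ≡ true
                 → P (findFrom P s fuel) ≡ true × s ≤ findFrom P s fuel × findFrom P s fuel < s + fuel
findFrom-correct P s zero z s≤z z<s+0 _ = ⊥-elim (<⇒≱ z<s+0 (≤-trans (≤-reflexive (+-identityʳ s)) s≤z))
findFrom-correct P s (suc fuel) z s≤z z< Pz with P s in Ps
... | true  = Ps , ≤-refl , ≤-trans (s≤s (m≤m+n s fuel)) (≤-reflexive (sym (+-suc s fuel)))
... | false with findFrom-correct P (suc s) fuel z (≤∧≢⇒< s≤z s≢z) (≤-trans z< (≤-reflexive (+-suc s fuel))) Pz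
  where
  s≢z : s ≢ z
  s≢z refl with () ← trans (sym Ps) Pz
... | found , lower , upper = found , ≤-trans (n≤1+n s) lower , ≤-trans upper (≤-reflexive (sym (+-suc s fuel)))

-- The search defining b_k(L) finds some inverse
-- in that range, which coincides with z by uniqueness.
b-unique : ∀ k L {z y} → 1 ≤ z → z < 3 ^ k → z * 2 ^ L ≡ 1 + y * 3 ^ k → b k L ≡ z
b-unique k L {z} {y} 1≤z z<A ez = inverse-unique (odd-3^ k) L {s = b k L * 2 ^ L / A} {y} b<A z<A b-inverse ez
  where
  open ≡-Reasoning
  A = 3 ^ k
  instance
    A-nonZero : NonZero A
    A-nonZero = m^n≢0 3 k
  1<A : 1 < A
  1<A = ≤-<-trans 1≤z z<A
  range : 1 + (A ∸ 1) ≡ A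
  range = m+[n∸m]≡n (<⇒≤ 1<A)
  isInverse : ℕ → Bool
  isInverse m = (m * 2 ^ L) % A ≡ᵇ 1
  z-isInverse : isInverse z ≡ true
  z-isInverse = cong (_≡ᵇ 1) (begin
    (z * 2 ^ L) % A    ≡⟨ cong (_% A) ez ⟩
    (1 + y * A) % A    ≡⟨ [m+kn]%n≡m%n 1 y A ⟩
    1 % A              ≡⟨ m<n⇒m%n≡m 1<A ⟩
    1                  ∎)
  search = findFrom-correct isInverse 1 (A ∸ 1) z 1≤z (≤-trans z<A (≤-reflexive (sym range))) z-isInverse
  b<A : b k L < A
  b<A = ≤-trans (proj₂ (proj₂ search)) (≤-reflexive range)
  b-inverse : b k L * 2 ^ L ≡ 1 + (b k L * 2 ^ L / A) * A
  b-inverse = trans (m≡m%n+[m/n]*n _ A)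
                    (cong (_+ (b k L * 2 ^ L / A) * A) (≡ᵇ⇒≡ _ 1 (subst True (sym (proj₁ search)) tt)))

nj-from-inverse : ∀ k q {z y} → 1 ≤ z → z < 3 ^ suc k → z * 2 ^ suc q ≡ 1 + y * 3 ^ suc k
                → nj (suc (suc k + q)) (suc k) ≡ 2 ^ suc k * y ∸ 1
nj-from-inverse k q {z} {y} 1≤z z<A ez = begin
  nj (suc (suc k + q)) (suc k)
    ≡⟨ cong (λ l → (2 ^ K * (b K l * 2 ^ l ∸ 1)) / A ∸ 1) j∸K≡L ⟩
  (2 ^ K * (b K L * 2 ^ L ∸ 1)) / A ∸ 1
    ≡⟨ cong (λ c → (2 ^ K * (c * 2 ^ L ∸ 1)) / A ∸ 1) (b-unique K L {y = y} 1≤z z<A ez) ⟩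
  (2 ^ K * (z * 2 ^ L ∸ 1)) / A ∸ 1
    ≡⟨ cong (λ v → (2 ^ K * (v ∸ 1)) / A ∸ 1) ez ⟩
  (2 ^ K * (y * A)) / A ∸ 1
    ≡⟨ cong (λ v → v / A ∸ 1) (sym (*-assoc (2 ^ K) y A)) ⟩
  (2 ^ K * y * A) / A ∸ 1
    ≡⟨ cong (_∸ 1) (m*n/n≡m (2 ^ K * y) A) ⟩
  2 ^ K * y ∸ 1 ∎
  where
  open ≡-Reasoning
  K = suc k
  L = suc q
  A = 3 ^ K
  instance
    A-nonZero : NonZero A
    A-nonZero = m^n≢0 3 K
  j∸K≡L : suc (suc k + q) ∸ K ≡ L
  j∸K≡L = trans (cong (_∸ k) (sym (+-suc k q))) (m+n∸m≡n k L)

-- Identifying the elements: the bound n ≤ 2^j pins down the parameters of a shape.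

≤-from-scaled : ∀ a y c → 2 ≤ a → a * y ≤ a * c + 1 → y ≤ c
≤-from-scaled a y c 2≤a ay≤ac+1 with y ≤? c
... | yes y≤c = y≤c
... | no  y≰c = ⊥-elim (<⇒≱ 2≤a (+-cancelʳ-≤ (a * c) a 1 (begin
  a + a * c   ≡⟨ sym (*-suc a c) ⟩
  a * suc c   ≤⟨ *-monoʳ-≤ a (≰⇒> y≰c) ⟩
  a * y       ≤⟨ ay≤ac+1 ⟩
  a * c + 1   ≡⟨ +-comm (a * c) 1 ⟩
  1 + a * c   ∎)))
  where open ≤-Reasoning

2<2^ : ∀ q → 1 ≤ q → 2 < 2 ^ suc q
2<2^ q 1≤q = ≤-trans (s≤s (s≤s (s≤s z≤n))) (*-monoʳ-≤ 2 (^-monoʳ-≤ 2 1≤q))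

-- p = 0: n + 2 = 2^j z with n ≤ 2^j forces z = 1, i.e. n = 2^j − 2.
shape₀⇒top : ∀ q n → 1 ≤ q → Shape 0 q n → n ≤ 2 ^ suc q → n ≡ 2 ^ suc q ∸ 2
shape₀⇒top q n _ (shape y zero before after) _ =
  ⊥-elim (m+1+n≢0 (n + 1) (trans (cong (_+ 1) before) (trans after (*-zeroʳ (2 ^ suc q)))))
shape₀⇒top q n _ (shape y 1 before after) _ = begin
  n                  ≡⟨ sym (m+n∸n≡m n 2) ⟩
  n + 2 ∸ 2          ≡⟨ cong (_∸ 2) (trans (sym (+-assoc n 1 1)) (trans (cong (_+ 1) before) after)) ⟩
  2 ^ suc q * 1 ∸ 2  ≡⟨ cong (_∸ 2) (*-identityʳ (2 ^ suc q)) ⟩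
  2 ^ suc q ∸ 2      ∎
  where open ≡-Reasoning
shape₀⇒top q n 1≤q (shape y (suc (suc z)) before after) n≤X =
  ⊥-elim (<⇒≱ (2<2^ q 1≤q) (+-cancelˡ-≤ X X 2 (begin
    X + X                  ≤⟨ +-monoʳ-≤ X (m≤m+n X (z * X)) ⟩
    suc (suc z) * X        ≡⟨ *-comm (suc (suc z)) X ⟩
    X * suc (suc z)        ≡⟨ sym (trans (cong (_+ 1) before) after) ⟩
    n + 1 + 1              ≡⟨ +-assoc n 1 1 ⟩
    n + 2                  ≤⟨ +-monoˡ-≤ 2 n≤X ⟩
    X + 2                  ∎)))
  where
  open ≤-Reasoning
  X = 2 ^ suc q

2^-split : ∀ p q → 2 ^ p * 2 ^ suc q ≡ 2 ^ suc (p + q)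
2^-split p q = trans (sym (^-distribˡ-+-* 2 p (suc q))) (cong (2 ^_) (+-suc p q))

1<3^suc : ∀ k → 1 < 3 ^ suc k
1<3^suc k = ≤-trans (s≤s (s≤s z≤n)) (*-monoʳ-≤ 3 (m^n>0 3 k))

-- p = k ≥ 1: n ≤ 2^j forces y < 2^L (y = 2^L is excluded by parity), hence
-- 2^L z = 3^k y + 1 < 3^k 2^L; so z is an inverse of 2^L modulo 3^k in range.
shape⇒nj : ∀ k q n → Shape (suc k) q n → n ≤ 2 ^ suc (suc k + q) → n ≡ nj (suc (suc k + q)) (suc k)
shape⇒nj k q n (shape y z before after) n≤2^j = trans n≡ (sym (nj-from-inverse k q 1≤z z<A ez))
  where
  open ≤-Reasoning
  K = suc k
  L = suc q
  A = 3 ^ K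
  y≤2^L : y ≤ 2 ^ L
  y≤2^L = ≤-from-scaled (2 ^ K) y (2 ^ L) (^-monoʳ-≤ 2 {1} {K} (s≤s z≤n)) (begin
    2 ^ K * y          ≡⟨ sym before ⟩
    n + 1              ≤⟨ +-monoˡ-≤ 1 n≤2^j ⟩
    2 ^ suc (K + q) + 1 ≡⟨ cong (_+ 1) (sym (2^-split K q)) ⟩
    2 ^ K * 2 ^ L + 1  ∎)
  y≢2^L : y ≢ 2 ^ L
  y≢2^L refl = even≢odd (2 ^ q * z) (A * 2 ^ q) (sym (begin-equality
    suc (2 * (A * 2 ^ q))  ≡⟨ cong suc (x∙yz≈y∙xz 2 A (2 ^ q)) ⟩
    suc (A * 2 ^ L)        ≡⟨ +-comm 1 (A * 2 ^ L) ⟩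
    A * 2 ^ L + 1          ≡⟨ after ⟩
    2 ^ L * z              ≡⟨ *-assoc 2 (2 ^ q) z ⟩
    2 * (2 ^ q * z)        ∎))
  z<A : z < A
  z<A = *-cancelˡ-< (2 ^ L) z A (begin-strict
    2 ^ L * z    ≡⟨ sym after ⟩
    A * y + 1    <⟨ +-monoʳ-< (A * y) (1<3^suc k) ⟩
    A * y + A    ≡⟨ trans (+-comm (A * y) A) (sym (*-suc A y)) ⟩
    A * suc y    ≤⟨ *-monoʳ-≤ A (≤∧≢⇒< y≤2^L y≢2^L) ⟩
    A * 2 ^ L    ≡⟨ *-comm A (2 ^ L) ⟩
    2 ^ L * A    ∎)
  1≤z : 1 ≤ z
  1≤z = n≢0⇒n>0 λ { refl → m+1+n≢0 (A * y) (trans after (*-zeroʳ (2 ^ L))) }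
  ez : z * 2 ^ L ≡ 1 + y * A
  ez = trans (*-comm z (2 ^ L)) (trans (sym after) (trans (+-comm (A * y) 1) (cong (1 +_) (*-comm A y))))
  n≡ : n ≡ 2 ^ K * y ∸ 1
  n≡ = trans (sym (m+n∸n≡m n 1)) (cong (_∸ 1) before)

shape⇒candidate : ∀ j n → HasShape j n → 2 ≤ j → n ≤ 2 ^ j
                → ∃[ k ] (k < j × n ≡ nj j k)
shape⇒candidate _ n (zero  , q , refl , s) 2≤j n≤2^j = 0 , s≤s z≤n , shape₀⇒top q n (s≤s⁻¹ 2≤j) s n≤2^j
shape⇒candidate _ n (suc k , q , refl , s) _   n≤2^j = suc k , s≤s (s≤s (m≤m+n k q)) , shape⇒nj k q n s n≤2^j

I0⊆nj : ∀ j n → 2 ≤ j → InI0 j n → ∃[ k ] (k < j × n ≡ nj j k)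
I0⊆nj j n 2≤j n∈I0 = shape⇒candidate j n (InI0⇒shape j n (<⇒≤ 2≤j) n∈I0) 2≤j (proj₁ (proj₂ n∈I0))

shape⇒InI0 : ∀ p q n → Shape p q n → 1 ≤ n → n ≤ 2 ^ suc (p + q) → InI0 (suc (p + q)) n
shape⇒InI0 p q n s 1≤n n≤2^j = 1≤n , n≤2^j , shape⇒count p q n s

-- n_{j,0} = 2^j − 2: one even step followed by j − 1 odd steps.
top∈I0 : ∀ q → InI0 (suc (suc q)) (nj (suc (suc q)) 0)
top∈I0 q = shape⇒InI0 0 (suc q) n (shape (n + 1) 1 (sym (*-identityˡ (n + 1))) after)
                      (∸-monoˡ-≤ 2 (2<2^ (suc q) (s≤s z≤n))) (m∸n≤m X 2)
  where
  X = 2 ^ suc (suc q)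
  n = X ∸ 2
  after : 1 * (n + 1) + 1 ≡ X * 1
  after = trans (cong (_+ 1) (*-identityˡ (n + 1)))
                (trans (+-assoc n 1 1) (trans (m∸n+n≡m (<⇒≤ (2<2^ (suc q) (s≤s z≤n)))) (sym (*-identityʳ X))))

-- n_{j,k} for k ≥ 1: take the inverse z of 2^L modulo 3^k and n = 2^k y − 1.
nj∈I0 : ∀ k q → InI0 (suc (suc k + q)) (nj (suc (suc k + q)) (suc k))
nj∈I0 k q with inverse-exists (odd-3^ (suc k)) (1<3^suc k) (suc q)
... | z , y , 1≤z , z<A , ez =
  subst (InI0 (suc (K + q))) (sym (nj-from-inverse k q 1≤z z<A ez))
        (shape⇒InI0 K q n (shape y z before after) (∸-monoˡ-≤ 1 2≤2^Ky) n≤2^j)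
  where
  open ≤-Reasoning
  K = suc k
  L = suc q
  A = 3 ^ K
  n = 2 ^ K * y ∸ 1
  y≢0 : y ≢ 0
  y≢0 refl = even≢odd (z * 2 ^ q) 0 (trans (sym (x∙yz≈y∙xz z 2 (2 ^ q))) ez)
  2≤2^Ky : 2 ≤ 2 ^ K * y
  2≤2^Ky = ≤-trans (^-monoʳ-≤ 2 {1} {K} (s≤s z≤n)) (m≤m*n (2 ^ K) y {{≢-nonZero y≢0}})
  before : n + 1 ≡ 2 ^ K * y
  before = m∸n+n≡m (≤-trans (s≤s z≤n) 2≤2^Ky)
  after : A * y + 1 ≡ 2 ^ L * z
  after = trans (+-comm (A * y) 1) (trans (cong (1 +_) (*-comm A y)) (trans (sym ez) (*-comm z (2 ^ L))))
  y<2^L : y < 2 ^ L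
  y<2^L = *-cancelʳ-< A y (2 ^ L) (begin-strict
    y * A      <⟨ n<1+n (y * A) ⟩
    1 + y * A  ≡⟨ sym ez ⟩
    z * 2 ^ L  ≤⟨ *-monoˡ-≤ (2 ^ L) (<⇒≤ z<A) ⟩
    A * 2 ^ L  ≡⟨ *-comm A (2 ^ L) ⟩
    2 ^ L * A  ∎)
  n≤2^j : n ≤ 2 ^ suc (K + q)
  n≤2^j = begin
    2 ^ K * y ∸ 1    ≤⟨ m∸n≤m (2 ^ K * y) 1 ⟩
    2 ^ K * y        ≤⟨ *-monoʳ-≤ (2 ^ K) (<⇒≤ y<2^L) ⟩
    2 ^ K * 2 ^ L    ≡⟨ 2^-split K q ⟩
    2 ^ suc (K + q)  ∎

nj⊆I0 : ∀ j n → 2 ≤ j → ∃[ k ] (k < j × n ≡ nj j k) → InI0 j n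
nj⊆I0 (suc zero)    n (s≤s ()) _
nj⊆I0 (suc (suc q)) n _ (zero , _ , refl) = top∈I0 q
nj⊆I0 j n _ (suc k , k<j , refl) with m≤n⇒∃[o]m+o≡n k<j
... | q , refl = nj∈I0 k q

-- The lower bound 2^(j/(1+ρ)) ≤ n + 2.

^-distribʳ-* : ∀ a c n → (a * c) ^ n ≡ a ^ n * c ^ n
^-distribʳ-* a c zero    = refl
^-distribʳ-* a c (suc n) = trans (cong (a * c *_) (^-distribʳ-* a c n)) (regroup a c (a ^ n) (c ^ n))
  where
  regroup : ∀ a b x y → a * b * (x * y) ≡ a * x * (b * y)
  regroup = solve-∀

2^-cancel-< : ∀ a c → 2 ^ a < 2 ^ c → a < c
2^-cancel-< a c 2^a<2^c with c ≤? a
... | yes c≤a = ⊥-elim (<⇒≱ 2^a<2^c (^-monoʳ-≤ 2 c≤a))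
... | no  c≰a = ≰⇒> c≰a

-- Raising 2^j ≤ x 3^p to the power S Q and using x^S < 2^R, 3^Q < 2^P:
-- j S Q < R Q + P p S.
exponent-bound : ∀ j p x P Q R S → 1 ≤ Q → 2 ^ j ≤ x * 3 ^ p → 3 ^ Q < 2 ^ P → x ^ S < 2 ^ R
               → j * S * Q < R * Q + P * (p * S)
exponent-bound j p x P Q R S 1≤Q 2^j≤x3^p 3^Q<2^P x^S<2^R = 2^-cancel-< _ _ (begin-strict
  2 ^ (j * S * Q)                        ≡⟨ trans (cong (2 ^_) (*-assoc j S Q)) (sym (^-*-assoc 2 j (S * Q))) ⟩
  (2 ^ j) ^ (S * Q)                      ≤⟨ ^-monoˡ-≤ (S * Q) 2^j≤x3^p ⟩
  (x * 3 ^ p) ^ (S * Q)                  ≡⟨ ^-distribʳ-* x (3 ^ p) (S * Q) ⟩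
  x ^ (S * Q) * (3 ^ p) ^ (S * Q)        ≤⟨ *-monoʳ-≤ (x ^ (S * Q)) 3-part ⟩
  x ^ (S * Q) * 2 ^ (P * (p * S))        <⟨ *-monoˡ-< (2 ^ (P * (p * S))) {{m^n≢0 2 (P * (p * S))}} x-part ⟩
  2 ^ (R * Q) * 2 ^ (P * (p * S))        ≡⟨ sym (^-distribˡ-+-* 2 (R * Q) (P * (p * S))) ⟩
  2 ^ (R * Q + P * (p * S))              ∎)
  where
  open ≤-Reasoning
  instance
    Q-nonZero : NonZero Q
    Q-nonZero = >-nonZero 1≤Q
  x-part : x ^ (S * Q) < 2 ^ (R * Q)
  x-part = begin-strict
    x ^ (S * Q)    ≡⟨ sym (^-*-assoc x S Q) ⟩
    (x ^ S) ^ Q    <⟨ ^-monoˡ-< Q x^S<2^R ⟩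
    (2 ^ R) ^ Q    ≡⟨ ^-*-assoc 2 R Q ⟩
    2 ^ (R * Q)    ∎
  swap : ∀ p S Q → p * (S * Q) ≡ Q * (p * S)
  swap = solve-∀
  3-part : (3 ^ p) ^ (S * Q) ≤ 2 ^ (P * (p * S))
  3-part = begin
    (3 ^ p) ^ (S * Q)      ≡⟨ trans (^-*-assoc 3 p (S * Q)) (cong (3 ^_) (swap p S Q)) ⟩
    3 ^ (Q * (p * S))      ≡⟨ sym (^-*-assoc 3 Q (p * S)) ⟩
    (3 ^ Q) ^ (p * S)      ≤⟨ ^-monoˡ-≤ (p * S) (<⇒≤ 3^Q<2^P) ⟩
    (2 ^ P) ^ (p * S)      ≡⟨ ^-*-assoc 2 P (p * S) ⟩
    2 ^ (P * (p * S))      ∎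

-- 2^j ≤ x 3^p and 2^p ≤ x give j ≤ log₂ x + p ρ ≤ (1 + ρ) log₂ x, i.e. LowerBound j x:
-- with R/S > log₂ x we have p S < R, so j S Q < R Q + P p S < R (Q + P).
lowerBound-from : ∀ j p x → 2 ^ j ≤ x * 3 ^ p → 2 ^ p ≤ x → LowerBound j x
lowerBound-from j p x 2^j≤x3^p 2^p≤x P Q R S 1≤Q _ 3^Q<2^P x^S<2^R = begin-strict
  j * S * Q              <⟨ exponent-bound j p x P Q R S 1≤Q 2^j≤x3^p 3^Q<2^P x^S<2^R ⟩
  R * Q + P * (p * S)    ≤⟨ +-monoʳ-≤ (R * Q) (*-monoʳ-≤ P (<⇒≤ pS<R)) ⟩
  R * Q + P * R          ≡⟨ factor R Q P ⟩
  R * (Q + P)            ∎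
  where
  open ≤-Reasoning
  factor : ∀ R Q P → R * Q + P * R ≡ R * (Q + P)
  factor = solve-∀
  pS<R : p * S < R
  pS<R = 2^-cancel-< (p * S) R (begin-strict
    2 ^ (p * S)  ≡⟨ sym (^-*-assoc 2 p S) ⟩
    (2 ^ p) ^ S  ≤⟨ ^-monoˡ-≤ S 2^p≤x ⟩
    x ^ S        <⟨ x^S<2^R ⟩
    2 ^ R        ∎)

-- An element of shape (p, q) satisfies 2^j ≤ (n + 2) 3^p and 2^p ≤ n + 2, since
-- 2^p 2^(q+1) ≤ 2^p 2^(q+1) z = 3^p (n + 1) + 2^p and 2^p ≤ 2^p y = n + 1.
shape⇒bounds : ∀ p q n → Shape p q n → 2 ^ suc (p + q) ≤ (n + 2) * 3 ^ p × 2 ^ p ≤ n + 2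
shape⇒bounds p q n (shape y z before after) = 2^j≤ , 2^p≤
  where
  open ≤-Reasoning
  z≢0 : z ≢ 0
  z≢0 refl = m+1+n≢0 (3 ^ p * y) (trans after (*-zeroʳ (2 ^ suc q)))
  y≢0 : y ≢ 0
  y≢0 refl = m+1+n≢0 n (trans before (*-zeroʳ (2 ^ p)))
  expand : ∀ a c y → a * (c * y + 1) ≡ c * (a * y) + a
  expand = solve-∀
  collect : ∀ c n → c * (n + 1) + c ≡ (n + 2) * c
  collect = solve-∀
  2^j≤ : 2 ^ suc (p + q) ≤ (n + 2) * 3 ^ p
  2^j≤ = begin
    2 ^ suc (p + q)                ≡⟨ sym (2^-split p q) ⟩
    2 ^ p * 2 ^ suc q              ≤⟨ *-monoʳ-≤ (2 ^ p) (m≤m*n (2 ^ suc q) z {{≢-nonZero z≢0}}) ⟩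
    2 ^ p * (2 ^ suc q * z)        ≡⟨ cong (2 ^ p *_) (sym after) ⟩
    2 ^ p * (3 ^ p * y + 1)        ≡⟨ expand (2 ^ p) (3 ^ p) y ⟩
    3 ^ p * (2 ^ p * y) + 2 ^ p    ≤⟨ +-monoʳ-≤ (3 ^ p * (2 ^ p * y)) (^-monoˡ-≤ p (s≤s (s≤s z≤n))) ⟩
    3 ^ p * (2 ^ p * y) + 3 ^ p    ≡⟨ cong (λ v → 3 ^ p * v + 3 ^ p) (sym before) ⟩
    3 ^ p * (n + 1) + 3 ^ p        ≡⟨ collect (3 ^ p) n ⟩
    (n + 2) * 3 ^ p                ∎
  2^p≤ : 2 ^ p ≤ n + 2
  2^p≤ = begin
    2 ^ p      ≤⟨ m≤m*n (2 ^ p) y {{≢-nonZero y≢0}} ⟩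
    2 ^ p * y  ≡⟨ sym before ⟩
    n + 1      ≤⟨ +-monoʳ-≤ n (s≤s z≤n) ⟩
    n + 2      ∎

shape⇒lowerBound : ∀ j n → HasShape j n → LowerBound j (n + 2)
shape⇒lowerBound _ n (p , q , refl , s) =
  lowerBound-from (suc (p + q)) p (n + 2) (proj₁ (shape⇒bounds p q n s)) (proj₂ (shape⇒bounds p q n s))

lemma6p1 : ∀ j → 2 ≤ j
           → (∀ n → InI0 j n ⇔ (∃[ k ] (k < j × n ≡ nj j k)))
             × (∀ n → InI0 j n → LowerBound j (n + 2))
lemma6p1 j 2≤j = (λ n → mk⇔ (I0⊆nj j n 2≤j) (nj⊆I0 j n 2≤j))
               , λ n n∈I0 → shape⇒lowerBound j n (InI0⇒shape j n (<⇒≤ 2≤j) n∈I0)
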